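{- Let $A$ be a set of atoms and let $P$ be a proper logic program. Then $P$ has an $A$-based stable model if and only if $P(A)$ has an $A$-based stable model $M=A\cup\{a\}$ such that $a\notin\{a_r\colon r\in P'(A)\}$.
   Context: A logic program is a finite set of rules $r$ of the form $a \leftarrow b_1,\ldots,b_s,\mathbf{not}(c_1),\ldots,\mathbf{not}(c_t)$ ($a,b_i,c_j$ propositional atoms, no repeated atoms within $b^+(r)$ or within $b^-(r)$); $h(r)=a$, $b^+(r)=\{b_1,\ldots,b_s\}$, $b^-(r)=\{c_1,\ldots,c_t\}$; $\mathrm{At}(P)$ is the set of atoms of $P$. For $M$ a set of atoms, the reduct $P^M$ is obtained by deleting every rule $r$ with $b^-(r)\cap M\neq\emptyset$ and deleting negated atoms from the remaining rules; $LM(\cdot)$ denotes the least model of a Horn program; $M$ is a stable model of $P$ if $M=LM(P^M)$. A rule $r$ is proper if $h(r)\notin b^+(r)$ and $b^+(r)\cap b^-(r)=\emptyset$; a program is proper if all its rules are. $P(A)$ is the program of all rules $r\in P$ with $b^-(r)\cap A=\emptyset$ and $b^+(r)\subseteq A$. $P'(A)$ is the program of all rules $r\in P$ with $b^-(r)\cap A=\emptyset$, $h(r)\notin A$, and $b^+(r)\setminus A$ consisting of exactly one element, denoted $a_r$. A stable model $M$ of a program $R$ is $A$-based if $M=A\cup\{a\}$ for some $a\in\mathrm{At}(R)\setminus A$ and $M\subseteq LM(R(A)^M)$. -}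

module Defs where

open import Data.Nat using (ℕ)
open import Data.List using (List)
open import Data.List.Membership.Propositional using (_∈_; _∉_)
open import Data.List.Relation.Unary.All using (All)
open import Data.List.Relation.Unary.Unique.Propositional using (Unique)
open import Data.Product using (Σ; ∃; ∃-syntax; _×_; _,_)
open import Data.Sum using (_⊎_)
open import Relation.Binary.PropositionalEquality using (_≡_)
open import Relation.Nullary using (¬_)
open import Function.Bundles using (_⇔_)

Atom : Set
Atom = ℕ

-- A rule  a ← b₁,…,bₛ, not c₁,…,not cₜ
record Rule : Set where
  constructor rule
  field
    h  : Atom
    b⁺ : List Atom
    b⁻ : List Atom
open Rule public

Program : Set
Program = List Rule

WellFormed : Program → Set
WellFormed P = All (λ r → Unique (b⁺ r) × Unique (b⁻ r)) P

-- Programs viewed as (sub)sets of rules, so that P(A), P'(A) are programs too.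
RuleSet : Set₁
RuleSet = Rule → Set

⟦_⟧ : Program → RuleSet
⟦ P ⟧ r = r ∈ P

AtomSet : Set
AtomSet = List Atom

Disjoint : List Atom → AtomSet → Set
Disjoint xs A = ∀ x → x ∈ xs → x ∉ A

At : RuleSet → Atom → Set
At R x = ∃[ r ] (R r × (x ≡ h r ⊎ x ∈ b⁺ r ⊎ x ∈ b⁻ r))

HornRule : Set
HornRule = Atom × List Atom

HornProg : Set₁
HornProg = HornRule → Set

data LM (Q : HornProg) : Atom → Set where
  derive : ∀ {a bs} → Q (a , bs) → All (LM Q) bs → LM Q a

reduct : RuleSet → AtomSet → HornProg
reduct R M (a , bs) = ∃[ r ] (R r × Disjoint (b⁻ r) M × h r ≡ a × b⁺ r ≡ bs)

StableModel : RuleSet → AtomSet → Set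
StableModel R M = ∀ x → x ∈ M ⇔ LM (reduct R M) x

ProperRule : Rule → Set
ProperRule r = h r ∉ b⁺ r × Disjoint (b⁺ r) (b⁻ r)

Proper : Program → Set
Proper P = All ProperRule P

_⟨_⟩ : RuleSet → AtomSet → RuleSet
(R ⟨ A ⟩) r = R r × Disjoint (b⁻ r) A × (∀ x → x ∈ b⁺ r → x ∈ A)

-- r ∈ R'(A) with a_r = c  (b⁺(r) ∖ A = {c})
Prime-with : RuleSet → AtomSet → Rule → Atom → Set
Prime-with R A r c =
  R r × Disjoint (b⁻ r) A × h r ∉ A × (∀ x → (x ∈ b⁺ r × x ∉ A) ⇔ (x ≡ c))

ABasedWith : RuleSet → AtomSet → AtomSet → Atom → Set
ABasedWith R A M a =
  StableModel R M × At R a × a ∉ A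
  × (∀ x → x ∈ M ⇔ (x ∈ A ⊎ x ≡ a))
  × (∀ x → x ∈ M → LM (reduct (R ⟨ A ⟩) M) x)

ABased : RuleSet → AtomSet → AtomSet → Set
ABased R A M = ∃[ a ] ABasedWith R A M a

-- P(A) ⊆ P gives LM(P(A)^M) ⊆ LM(P^M), so the whole question is whether M = A ∪ {a} is
-- closed under the rules of P outside P(A).  A rule of P whose body holds in M either lies
-- in P(A), has its head in A, or lies in P'(A) with a_r = a.  Conversely, a rule of P'(A)
-- with a_r = a has its body true in M, so its head lands in M ∖ A = {a} ⊆ b⁺(r), which
-- properness forbids.
module Submission where

open import Defs
open import Data.Product using (∃-syntax; _×_; _,_; proj₁; proj₂)
open import Relation.Binary.PropositionalEquality using (_≢_; _≡_; refl; sym; subst)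
open import Function.Bundles using (_⇔_; mk⇔; Equivalence)
open import Data.Nat using (_≟_)
open import Data.List using (List)
open import Data.List.Membership.Propositional using (_∈_; _∉_; find)
open import Data.List.Membership.DecPropositional _≟_ using (_∈?_)
open import Data.List.Relation.Unary.All using (All; []; _∷_; all?; tabulate; lookup)
open import Data.List.Relation.Unary.All.Properties using (¬All⇒Any¬)
open import Data.Sum using (_⊎_; inj₁; inj₂)
open import Data.Empty using (⊥-elim)
open import Relation.Nullary using (¬_; yes; no)
open import Relation.Unary using (_⊆_)

open Equivalence using (to; from)

module _ {Q : HornProg} {S : Atom → Set}
         (closed : ∀ {a bs} → Q (a , bs) → All S bs → S a) where

  mutual
    LM-least : LM Q ⊆ S
    LM-least (derive q ds) = closed q (LM-least-All ds)

    LM-least-All : ∀ {xs} → All (LM Q) xs → All S xs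
    LM-least-All []       = []
    LM-least-All (d ∷ ds) = LM-least d ∷ LM-least-All ds

LM-mono : {Q Q′ : HornProg} → Q ⊆ Q′ → LM Q ⊆ LM Q′
LM-mono Q⊆Q′ = LM-least (λ q → derive (Q⊆Q′ q))

reduct-mono : {R R′ : RuleSet} {M : AtomSet} → R ⊆ R′ → reduct R M ⊆ reduct R′ M
reduct-mono R⊆R′ (r , Rr , rest) = r , R⊆R′ Rr , rest

restrict-⊆ : {R : RuleSet} {A : AtomSet} → R ⟨ A ⟩ ⊆ R
restrict-⊆ (Rr , _) = Rr

restrict-idem : {R : RuleSet} {A : AtomSet} → R ⟨ A ⟩ ⊆ (R ⟨ A ⟩) ⟨ A ⟩
restrict-idem r∈R⟨A⟩@(_ , disjoint , body⊆A) = r∈R⟨A⟩ , disjoint , body⊆A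

At-mono : {R R′ : RuleSet} → R ⊆ R′ → At R ⊆ At R′
At-mono R⊆R′ (r , Rr , occurs) = r , R⊆R′ Rr , occurs

LM-reduct⇒At : {R : RuleSet} {M : AtomSet} → LM (reduct R M) ⊆ At R
LM-reduct⇒At (derive (r , Rr , _ , refl , _) _) = r , Rr , inj₁ refl

ModelOfReduct : RuleSet → AtomSet → Set
ModelOfReduct R M =
  ∀ {r} → R r → Disjoint (b⁻ r) M → (∀ x → x ∈ b⁺ r → x ∈ M) → h r ∈ M

stable⇒modelOfReduct : {R : RuleSet} {M : AtomSet} → StableModel R M → ModelOfReduct R M
stable⇒modelOfReduct stable {r} Rr disjoint body⊆M =
  from (stable (h r))
    (derive (r , Rr , disjoint , refl , refl) (tabulate (λ {x} x∈b⁺ → to (stable x) (body⊆M x x∈b⁺))))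

modelOfReduct⇒stable : {R : RuleSet} {M : AtomSet} →
  (∀ x → x ∈ M → LM (reduct R M) x) → ModelOfReduct R M → StableModel R M
modelOfReduct⇒stable supported model x = mk⇔ (supported x) (LM-least closed)
  where
  closed : ∀ {a bs} → reduct _ _ (a , bs) → All (_∈ _) bs → a ∈ _
  closed (r , Rr , disjoint , refl , refl) body∈M = model Rr disjoint (λ _ → lookup body∈M)

stable-sub : {R R′ : RuleSet} {M : AtomSet} → R′ ⊆ R → StableModel R M →
  (∀ x → x ∈ M → LM (reduct R′ M) x) → StableModel R′ M
stable-sub R′⊆R stable supported x =
  mk⇔ (supported x) (λ d → from (stable x) (LM-mono (reduct-mono R′⊆R) d))

IsInsert : AtomSet → AtomSet → Atom → Set
IsInsert M A a = ∀ x → x ∈ M ⇔ (x ∈ A ⊎ x ≡ a)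

module _ {M A : AtomSet} {a : Atom} (M≡A∪a : IsInsert M A a) where

  ∈A⇒∈M : ∀ {x} → x ∈ A → x ∈ M
  ∈A⇒∈M x∈A = from (M≡A∪a _) (inj₁ x∈A)

  disjoint-M⇒disjoint-A : ∀ {xs} → Disjoint xs M → Disjoint xs A
  disjoint-M⇒disjoint-A xs∩M≡∅ x x∈xs x∈A = xs∩M≡∅ x x∈xs (∈A⇒∈M x∈A)

  ∈M∖A⇒≡ : ∀ {x} → x ∈ M → x ∉ A → x ≡ a
  ∈M∖A⇒≡ x∈M x∉A with to (M≡A∪a _) x∈M
  ... | inj₁ x∈A = ⊥-elim (x∉A x∈A)
  ... | inj₂ x≡a = x≡a

  ⊆insert⇒⊆∨outside≡ : a ∉ A → (xs : List Atom) → (∀ x → x ∈ xs → x ∈ M) →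
    (∀ x → x ∈ xs → x ∈ A) ⊎ (∀ x → (x ∈ xs × x ∉ A) ⇔ (x ≡ a))
  ⊆insert⇒⊆∨outside≡ a∉A xs xs⊆M with all? (_∈? A) xs
  ... | yes xs⊆A = inj₁ (λ _ → lookup xs⊆A)
  ... | no xs⊈A with find (¬All⇒Any¬ (_∈? A) xs xs⊈A)
  ...   | y , y∈xs , y∉A with ∈M∖A⇒≡ (xs⊆M y y∈xs) y∉A
  ...     | refl = inj₂ (λ x → mk⇔ (λ (x∈xs , x∉A) → ∈M∖A⇒≡ (xs⊆M x x∈xs) x∉A)
                                     (λ { refl → y∈xs , a∉A }))

  no-prime-rule : {R : RuleSet} → (∀ {r} → R r → ProperRule r) → StableModel R M →
    ∀ r → ¬ Prime-with R A r a
  no-prime-rule proper stable r (Rr , b⁻∩A≡∅ , h∉A , outside≡a) =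
    h∉b⁺ (subst (_∈ b⁺ r) (sym h≡a) a∈b⁺)
    where
    h∉b⁺ = proj₁ (proper Rr)
    b⁺∩b⁻≡∅ = proj₂ (proper Rr)
    a∈b⁺ : a ∈ b⁺ r
    a∈b⁺ = proj₁ (from (outside≡a a) refl)
    b⁺⊆M : ∀ x → x ∈ b⁺ r → x ∈ M
    b⁺⊆M x x∈b⁺ with x ∈? A
    ... | yes x∈A = ∈A⇒∈M x∈A
    ... | no x∉A  = from (M≡A∪a x) (inj₂ (to (outside≡a x) (x∈b⁺ , x∉A)))
    b⁻∩M≡∅ : Disjoint (b⁻ r) M
    b⁻∩M≡∅ x x∈b⁻ x∈M with to (M≡A∪a x) x∈M
    ... | inj₁ x∈A  = b⁻∩A≡∅ x x∈b⁻ x∈A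
    ... | inj₂ refl = b⁺∩b⁻≡∅ a a∈b⁺ x∈b⁻
    h≡a : h r ≡ a
    h≡a = ∈M∖A⇒≡ (stable⇒modelOfReduct stable Rr b⁻∩M≡∅ b⁺⊆M) h∉A

  restrict-model⇒model : {R : RuleSet} → a ∉ A → StableModel (R ⟨ A ⟩) M →
    (∀ r → ¬ Prime-with R A r a) → ModelOfReduct R M
  restrict-model⇒model a∉A stable no-prime {r} Rr b⁻∩M≡∅ b⁺⊆M
    with ⊆insert⇒⊆∨outside≡ a∉A (b⁺ r) b⁺⊆M
  ... | inj₁ b⁺⊆A = stable⇒modelOfReduct stable (Rr , disjoint-M⇒disjoint-A b⁻∩M≡∅ , b⁺⊆A) b⁻∩M≡∅ b⁺⊆M
  ... | inj₂ outside≡a with h r ∈? A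
  ...   | yes h∈A = ∈A⇒∈M h∈A
  ...   | no h∉A  = ⊥-elim (no-prime r (Rr , disjoint-M⇒disjoint-A b⁻∩M≡∅ , h∉A , outside≡a))

mainTheorem4 : (A : AtomSet) (P : Program) → WellFormed P → Proper P →
    (∃[ M ] ABased ⟦ P ⟧ A M)
    ⇔ (∃[ M ] ∃[ a ] (ABasedWith (⟦ P ⟧ ⟨ A ⟩) A M a
         × (∀ r c → Prime-with ⟦ P ⟧ A r c → a ≢ c)))
mainTheorem4 A P _ proper = mk⇔ forward backward
  where
  P⟨A⟩⊆P : ⟦ P ⟧ ⟨ A ⟩ ⊆ ⟦ P ⟧
  P⟨A⟩⊆P = restrict-⊆ {⟦ P ⟧} {A}

  forward : (∃[ M ] ABased ⟦ P ⟧ A M) →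
    ∃[ M ] ∃[ a ] (ABasedWith (⟦ P ⟧ ⟨ A ⟩) A M a × (∀ r c → Prime-with ⟦ P ⟧ A r c → a ≢ c))
  forward (M , a , stable , _ , a∉A , M≡A∪a , supported) =
    M , a , ( stable-sub P⟨A⟩⊆P stable supported
            , LM-reduct⇒At (supported a (from (M≡A∪a a) (inj₂ refl)))
            , a∉A , M≡A∪a
            , (λ x x∈M → LM-mono (reduct-mono (restrict-idem {⟦ P ⟧} {A})) (supported x x∈M)) )
      , λ { r _ prime refl → no-prime-rule M≡A∪a (lookup proper) stable r prime }

  backward : (∃[ M ] ∃[ a ] (ABasedWith (⟦ P ⟧ ⟨ A ⟩) A M a
               × (∀ r c → Prime-with ⟦ P ⟧ A r c → a ≢ c))) →
    ∃[ M ] ABased ⟦ P ⟧ A M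
  backward (M , a , (stable , at , a∉A , M≡A∪a , supported) , a≢a_r) =
    M , a , modelOfReduct⇒stable (λ x x∈M → LM-mono (reduct-mono P⟨A⟩⊆P) (supported′ x x∈M)) model
      , At-mono P⟨A⟩⊆P at , a∉A , M≡A∪a , supported′
    where
    supported′ : ∀ x → x ∈ M → LM (reduct (⟦ P ⟧ ⟨ A ⟩) M) x
    supported′ x x∈M = LM-mono (reduct-mono (restrict-⊆ {⟦ P ⟧ ⟨ A ⟩} {A})) (supported x x∈M)
    model : ModelOfReduct ⟦ P ⟧ M
    model = restrict-model⇒model M≡A∪a a∉A stable (λ r prime → a≢a_r r a prime refl)
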